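{- Let $q=2^m$ and let $f(x)\in\mathrm{GF}(q)[x]$ be an o-polynomial. For $u_1,u_2\in\mathrm{GF}(q)$ with $u_1\neq u_2$, define $$I(u_1,u_2)=\left\{(b,c)\in\mathrm{GF}(q)^2:\ b\neq 0,\ \{u_1,u_2\}\subseteq V(f(x)+bx+c)\right\}.$$ Then $|I(u_1,u_2)|=\frac{q(q-2)}{4}$.
   Context: For a polynomial $g$ over $\mathrm{GF}(q)$, its value set is $V(g)=\{g(x): x\in\mathrm{GF}(q)\}$. With $q=2^m$, an o-polynomial over $\mathrm{GF}(q)$ is a polynomial $f\in\mathrm{GF}(q)[x]$ with $\deg f<q$, $f(0)=0$, $f$ a permutation of $\mathrm{GF}(q)$, and such that for every $a\in\mathrm{GF}(q)$ the polynomial $(f(x+a)+f(a))x^{q-2}$ is also a permutation of $\mathrm{GF}(q)$ (the normalization $f(1)=1$ is not required). -}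

module Defs where

open import Data.Nat using (ℕ; zero; suc; _^_; _∸_)
open import Data.Fin using (Fin)
open import Data.List using (List; map; filter; length; allFin; cartesianProduct)
import Data.List.Relation.Unary.Any.Properties as AnyP0
open import Data.List.Membership.Propositional.Properties using (∈-map⁺; ∈-allFin)
open import Data.List.Relation.Unary.Any using (Any; any?)
import Data.List.Relation.Unary.Any as AnyP
open import Data.Vec using (Vec; []; _∷_)
open import Data.Product using (_×_; _,_; ∃; proj₁; proj₂)
open import Relation.Nullary using (¬_; Dec; yes; no)
open import Relation.Nullary.Decidable using (_×-dec_; ¬?)
open import Relation.Binary using (DecidableEquality)
open import Relation.Binary.PropositionalEquality using (_≡_; refl; subst)
import Algebra.Structures as AS
open import Function.Bundles using (_↔_; Inverse)
open import Function.Definitions using (Bijective)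

-- Any two finite fields of the same order are isomorphic, so
-- quantifying over all such structures amounts to fixing GF(2^m).
record GF2^ (m : ℕ) : Set₁ where
  infixl 6 _+_
  infixl 7 _*_
  field
    Carrier : Set
    _+_ _*_ : Carrier → Carrier → Carrier
    -_ : Carrier → Carrier
    0# 1# : Carrier
    isCommutativeRing : AS.IsCommutativeRing (_≡_ {A = Carrier}) _+_ _*_ -_ 0# 1#
    0≢1 : ¬ (0# ≡ 1#)
    inverse : ∀ x → ¬ (x ≡ 0#) → ∃ λ y → x * y ≡ 1#
    _≟_ : DecidableEquality Carrier
    enumeration : Carrier ↔ Fin (2 ^ m)

  q : ℕ
  q = 2 ^ m

  elements : List Carrier
  elements = map (Inverse.from enumeration) (allFin q)

  _^'_ : Carrier → ℕ → Carrier
  x ^' zero = 1#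
  x ^' suc n = x * (x ^' n)

  -- polynomials of degree < q, given by coefficient vectors
  -- (a₀ ∷ a₁ ∷ … ∷ a_{q-1} ∷ []) meaning Σ aᵢ xⁱ
  Poly : Set
  Poly = Vec Carrier q

  evalV : ∀ {n} → Vec Carrier n → Carrier → Carrier
  evalV [] x = 0#
  evalV (a ∷ as) x = a + x * evalV as x

  eval : Poly → Carrier → Carrier
  eval = evalV

  IsPermutation : (Carrier → Carrier) → Set
  IsPermutation g = Bijective _≡_ _≡_ g

  -- o-polynomial (without the normalisation f(1)=1)
  record IsOPolynomial (f : Poly) : Set where
    field
      zero-at-0 : eval f 0# ≡ 0#
      perm : IsPermutation (eval f)
      perm-a : ∀ a → IsPermutation
                       (λ x → (eval f (x + a) + eval f a) * (x ^' (q ∸ 2)))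

  _∈V_ : Carrier → (Carrier → Carrier) → Set
  u ∈V g = ∃ λ x → g x ≡ u

  ∈-elements : ∀ x → Any (x ≡_) elements
  ∈-elements x = subst (λ y → Any (y ≡_) elements)
                       (Inverse.strictlyInverseʳ enumeration x)
                       (∈-map⁺ (Inverse.from enumeration)
                               (∈-allFin (Inverse.to enumeration x)))

  _∈V?_ : ∀ u g → Dec (u ∈V g)
  u ∈V? g with any? (λ x → g x ≟ u) elements
  ... | yes p = yes (witness p)
    where
    witness : ∀ {xs} → Any (λ x → g x ≡ u) xs → u ∈V g
    witness (Any.here px) = _ , px
    witness (Any.there p) = witness p
  ... | no ¬p = no λ { (x , gx≡u) →
          ¬p (AnyP.map (λ { refl → gx≡u }) (∈-elements x)) }

  InI : Poly → Carrier → Carrier → Carrier × Carrier → Set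
  InI f u₁ u₂ (b , c) =
    ¬ (b ≡ 0#) × (u₁ ∈V g) × (u₂ ∈V g)
    where
    g : Carrier → Carrier
    g x = eval f x + b * x + c

  InI? : ∀ f u₁ u₂ p → Dec (InI f u₁ u₂ p)
  InI? f u₁ u₂ (b , c) = ¬? (b ≟ 0#) ×-dec (u₁ ∈V? _ ×-dec u₂ ∈V? _)

  cardI : Poly → Carrier → Carrier → ℕ
  cardI f u₁ u₂ = length (filter (InI? f u₁ u₂) (cartesianProduct elements elements))

module Submission where

-- We show
-- 4 |I(u₁,u₂)| = q (q - 2) by double counting.
--   * The field has characteristic 2 (Fermat: -1 = (-1)^(q-1) = 1 as q-1 is odd).
--   * For b ≠ 0 the map g_b(x) = f(x) + b x is two-to-one: the o-polynomial
--     condition says that chord slopes from any x₀ are all distinct, so each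
--     value of g_b is taken exactly twice.  Hence a pair (b, c) ∈ I(u₁,u₂) is
--     witnessed by 2·2 pairs (x, y) with g_b(x) = u₁ + c, g_b(y) = u₂ + c,
--     i.e. 4 |I| counts the triples (b ≠ 0, x, y) with g_b(x) + g_b(y) = u₁ + u₂.
--   * For fixed x ≠ y this linear equation in b has one solution, nonzero iff
--     f(x) + f(y) ≠ u₁ + u₂; as f is a permutation, for each x exactly q - 2
--     points y qualify.

open import Defs
open import Data.Nat using (ℕ; _*_; _∸_; _/_)
open import Relation.Nullary using (¬_)
open import Relation.Binary.PropositionalEquality using (_≡_)

open import Data.Nat using (zero; suc; _+_; _^_)
import Data.Nat.Properties as ℕ
open import Data.Nat.DivMod using (m*n/n≡m)
open import Data.Nat.Tactic.RingSolver using (solve-∀)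
open import Data.Fin as Fin using (Fin; zero; suc)
import Data.Fin.Properties as Fin
open import Data.List using (List; []; _∷_; _++_; map; filter; length; tabulate; allFin; cartesianProduct)
open import Data.List.Properties using (map-tabulate)
open import Data.Product using (_×_; _,_; proj₁; proj₂; ∃)
open import Data.Sum using (_⊎_; inj₁; inj₂; [_,_]′)
open import Data.Empty using (⊥-elim)
open import Function using (_∘_; id; _⇔_; mk⇔; _↔_; Inverse; Equivalence)
open import Relation.Nullary using (Dec; yes; no; does)
open import Relation.Nullary.Decidable using (¬?; _×-dec_; _⊎-dec_)
open import Relation.Unary using (Decidable)
open import Relation.Binary using (DecidableEquality)
open import Relation.Binary.PropositionalEquality using (refl; sym; trans; cong; cong₂; subst; module ≡-Reasoning)
open import Algebra.Bundles using (CommutativeRing)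
import Algebra.Properties.Ring as RingProperties
import Algebra.Properties.CommutativeSemigroup as CommutativeSemigroupProperties
import Algebra.Properties.CommutativeMonoid.Sum as MonoidSum
open import Data.Fin.Permutation using (Permutation; permutation)
open import Data.Bool using (if_then_else_)
open import Algebra.Properties.Semiring.Sum ℕ.+-*-semiring
  using (sum; sum-cong-≗; ∑-distrib-+; ∑-comm; *-distribˡ-sum; *-distribʳ-sum)

⟦_⟧ : ∀ {p} {P : Set p} → Dec P → ℕ
⟦ yes _ ⟧ = 1
⟦ no _ ⟧ = 0

⟦⟧-yes : ∀ {p} {P : Set p} (d : Dec P) → P → ⟦ d ⟧ ≡ 1
⟦⟧-yes (yes _) _ = refl
⟦⟧-yes (no ¬p) p = ⊥-elim (¬p p)

⟦⟧-no : ∀ {p} {P : Set p} (d : Dec P) → ¬ P → ⟦ d ⟧ ≡ 0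
⟦⟧-no (yes p) ¬p = ⊥-elim (¬p p)
⟦⟧-no (no _) _ = refl

⟦⟧-cong : ∀ {p q} {P : Set p} {Q : Set q} (d : Dec P) (e : Dec Q) →
  (P → Q) → (Q → P) → ⟦ d ⟧ ≡ ⟦ e ⟧
⟦⟧-cong (yes p) e to _ = sym (⟦⟧-yes e (to p))
⟦⟧-cong (no ¬p) e _ from = sym (⟦⟧-no e (¬p ∘ from))

⟦⟧-× : ∀ {p q} {P : Set p} {Q : Set q} (d : Dec P) (e : Dec Q) → ⟦ d ×-dec e ⟧ ≡ ⟦ d ⟧ * ⟦ e ⟧
⟦⟧-× (yes p) e = trans (⟦⟧-cong (yes p ×-dec e) e proj₂ (p ,_)) (sym (ℕ.+-identityʳ ⟦ e ⟧))
⟦⟧-× (no ¬p) e = ⟦⟧-no (no ¬p ×-dec e) (¬p ∘ proj₁)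

⟦⟧-¬ : ∀ {p} {P : Set p} (d : Dec P) → ⟦ ¬? d ⟧ + ⟦ d ⟧ ≡ 1
⟦⟧-¬ (yes _) = refl
⟦⟧-¬ (no _) = refl

⟦⟧-guard : ∀ {p} {P : Set p} (d : Dec P) {a b : ℕ} → (P → a ≡ b) → ⟦ d ⟧ * a ≡ ⟦ d ⟧ * b
⟦⟧-guard (yes p) eq = cong (_+ 0) (eq p)
⟦⟧-guard (no _) _ = refl

weight : ∀ {a} {A : Set a} → (A → ℕ) → List A → ℕ
weight h [] = 0
weight h (x ∷ xs) = h x + weight h xs

length-filter : ∀ {a p} {A : Set a} {P : A → Set p} (P? : Decidable P) xs →
  length (filter P? xs) ≡ weight (λ x → ⟦ P? x ⟧) xs
length-filter P? [] = refl
length-filter P? (x ∷ xs) with P? x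
... | yes _ = cong suc (length-filter P? xs)
... | no _ = length-filter P? xs

weight-++ : ∀ {a} {A : Set a} (h : A → ℕ) (xs ys : List A) →
  weight h (xs ++ ys) ≡ weight h xs + weight h ys
weight-++ h [] ys = refl
weight-++ h (x ∷ xs) ys = trans (cong (h x +_) (weight-++ h xs ys)) (sym (ℕ.+-assoc (h x) _ _))

weight-map : ∀ {a b} {A : Set a} {B : Set b} (h : B → ℕ) (g : A → B) (xs : List A) →
  weight h (map g xs) ≡ weight (h ∘ g) xs
weight-map h g [] = refl
weight-map h g (x ∷ xs) = cong (h (g x) +_) (weight-map h g xs)

weight-cartesianProduct : ∀ {a b} {A : Set a} {B : Set b} (h : A × B → ℕ) (xs : List A) (ys : List B) →
  weight h (cartesianProduct xs ys) ≡ weight (λ x → weight (λ y → h (x , y)) ys) xs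
weight-cartesianProduct h [] ys = refl
weight-cartesianProduct h (x ∷ xs) ys = trans (weight-++ h (map (x ,_) ys) _)
  (cong₂ _+_ (weight-map h (x ,_) ys) (weight-cartesianProduct h xs ys))

weight-tabulate : ∀ {a n} {A : Set a} (h : A → ℕ) (g : Fin n → A) → weight h (tabulate g) ≡ sum (h ∘ g)
weight-tabulate {n = zero} h g = refl
weight-tabulate {n = suc n} h g = cong (h (g zero) +_) (weight-tabulate h (g ∘ suc))

sum-const : ∀ n k → sum {n} (λ _ → k) ≡ n * k
sum-const zero k = refl
sum-const (suc n) k = cong (k +_) (sum-const n k)

sum-point : ∀ {n} (j : Fin n) → sum (λ i → ⟦ i Fin.≟ j ⟧) ≡ 1
sum-point {suc n} zero = cong suc (trans (sum-cong-≗ {n} (λ i → ⟦⟧-no (suc i Fin.≟ zero) λ ()))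
                                         (trans (sum-const n 0) (ℕ.*-zeroʳ n)))
sum-point {suc n} (suc j) = trans
  (sum-cong-≗ {n} (λ i → ⟦⟧-cong (suc i Fin.≟ suc j) (i Fin.≟ j) Fin.suc-injective (cong suc)))
  (sum-point j)

module FiniteSum {A : Set} {n : ℕ} (_≟_ : DecidableEquality A) (enum : A ↔ Fin n) where

  open Inverse enum public using (to; from)
  open ≡-Reasoning

  to-from : ∀ i → to (from i) ≡ i
  to-from = Inverse.strictlyInverseˡ enum

  from-to : ∀ x → from (to x) ≡ x
  from-to = Inverse.strictlyInverseʳ enum

  Σ : (A → ℕ) → ℕ
  Σ h = sum (h ∘ from)

  Σ-cong : ∀ {h k : A → ℕ} → (∀ x → h x ≡ k x) → Σ h ≡ Σ k
  Σ-cong eq = sum-cong-≗ (eq ∘ from)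

  Σ-+ : ∀ (h k : A → ℕ) → Σ (λ x → h x + k x) ≡ Σ h + Σ k
  Σ-+ h k = ∑-distrib-+ (h ∘ from) (k ∘ from)

  Σ-*ˡ : ∀ c (h : A → ℕ) → Σ (λ x → c * h x) ≡ c * Σ h
  Σ-*ˡ c h = sym (*-distribˡ-sum c (h ∘ from))

  Σ-comm : ∀ (h : A → A → ℕ) → Σ (λ x → Σ (h x)) ≡ Σ (λ y → Σ (λ x → h x y))
  Σ-comm h = ∑-comm (λ i j → h (from i) (from j))

  Σ-const : ∀ c → Σ (λ _ → c) ≡ n * c
  Σ-const = sum-const n

  Σ-zero : ∀ {h : A → ℕ} → (∀ x → h x ≡ 0) → Σ h ≡ 0
  Σ-zero eq = trans (Σ-cong eq) (trans (Σ-const 0) (ℕ.*-zeroʳ n))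

  Σ-product : ∀ (h k : A → ℕ) → Σ h * Σ k ≡ Σ (λ x → Σ (λ y → h x * k y))
  Σ-product h k = begin
    Σ h * Σ k                          ≡⟨ *-distribʳ-sum (Σ k) (h ∘ from) ⟩
    Σ (λ x → h x * Σ k)                ≡⟨ Σ-cong (λ x → sym (Σ-*ˡ (h x) k)) ⟩
    Σ (λ x → Σ (λ y → h x * k y))      ∎

  Σ-unique : ∀ {p} {P : A → Set p} (P? : Decidable P) a → P a → (∀ x → P x → x ≡ a) →
    Σ (λ x → ⟦ P? x ⟧) ≡ 1
  Σ-unique {P = P} P? a pa unique = trans
    (sum-cong-≗ (λ i → ⟦⟧-cong (P? (from i)) (i Fin.≟ to a)
      (λ p → trans (sym (to-from i)) (cong to (unique _ p)))
      (λ { refl → subst P (sym (from-to a)) pa })))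
    (sum-point (to a))

  Σ-pair : ∀ {p} {P : A → Set p} (P? : Decidable P) a b → ¬ a ≡ b →
    (∀ x → P x ⇔ (x ≡ a ⊎ x ≡ b)) → Σ (λ x → ⟦ P? x ⟧) ≡ 2
  Σ-pair P? a b a≢b P⇔ = begin
    Σ (λ x → ⟦ P? x ⟧)                     ≡⟨ Σ-cong split ⟩
    Σ (λ x → ⟦ x ≟ a ⟧ + ⟦ x ≟ b ⟧)        ≡⟨ Σ-+ (λ x → ⟦ x ≟ a ⟧) (λ x → ⟦ x ≟ b ⟧) ⟩
    Σ (λ x → ⟦ x ≟ a ⟧) + Σ (λ x → ⟦ x ≟ b ⟧)
      ≡⟨ cong₂ _+_ (Σ-unique (_≟ a) a refl (λ _ → id)) (Σ-unique (_≟ b) b refl (λ _ → id)) ⟩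
    2                                       ∎
    where
    split : ∀ x → ⟦ P? x ⟧ ≡ ⟦ x ≟ a ⟧ + ⟦ x ≟ b ⟧
    split x with x ≟ a | x ≟ b
    ... | yes refl | yes refl = ⊥-elim (a≢b refl)
    ... | yes x≡a | no _ = ⟦⟧-yes (P? x) (Equivalence.from (P⇔ x) (inj₁ x≡a))
    ... | no _ | yes x≡b = ⟦⟧-yes (P? x) (Equivalence.from (P⇔ x) (inj₂ x≡b))
    ... | no x≢a | no x≢b = ⟦⟧-no (P? x) λ px → [ x≢a , x≢b ]′ (Equivalence.to (P⇔ x) px)

  Σ-complement : ∀ {p} {P : A → Set p} (P? : Decidable P) →
    Σ (λ x → ⟦ ¬? (P? x) ⟧) ≡ n ∸ Σ (λ x → ⟦ P? x ⟧)
  Σ-complement P? = begin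
    Σ¬P                   ≡⟨ sym (ℕ.m+n∸n≡m Σ¬P ΣP) ⟩
    Σ¬P + ΣP ∸ ΣP         ≡⟨ cong (_∸ ΣP) (sym (Σ-+ (λ x → ⟦ ¬? (P? x) ⟧) (λ x → ⟦ P? x ⟧))) ⟩
    Σ (λ x → ⟦ ¬? (P? x) ⟧ + ⟦ P? x ⟧) ∸ ΣP
                          ≡⟨ cong (_∸ ΣP) (Σ-cong (⟦⟧-¬ ∘ P?)) ⟩
    Σ (λ _ → 1) ∸ ΣP      ≡⟨ cong (_∸ ΣP) (trans (Σ-const 1) (ℕ.*-identityʳ n)) ⟩
    n ∸ ΣP                ∎
    where
    Σ¬P = Σ (λ x → ⟦ ¬? (P? x) ⟧)
    ΣP = Σ (λ x → ⟦ P? x ⟧)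

  Σ-two-points : ∀ s t → Σ (λ x → ⟦ x ≟ s ⟧ * ⟦ x ≟ t ⟧) ≡ ⟦ s ≟ t ⟧
  Σ-two-points s t with s ≟ t
  ... | yes refl = trans (Σ-cong (λ x → sym (⟦⟧-× (x ≟ s) (x ≟ s))))
                         (Σ-unique (λ x → x ≟ s ×-dec x ≟ s) s (refl , refl) (λ _ → proj₁))
  ... | no s≢t = Σ-zero (λ x → trans (sym (⟦⟧-× (x ≟ s) (x ≟ t)))
                                      (⟦⟧-no (x ≟ s ×-dec x ≟ t) λ { (refl , refl) → s≢t refl }))

  weight-elements : ∀ (h : A → ℕ) → weight h (map from (allFin n)) ≡ Σ h
  weight-elements h = trans (cong (weight h) (map-tabulate id from)) (weight-tabulate h from)

module FieldFacts {m : ℕ} (F : GF2^ m) where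

  open GF2^ F renaming (_+_ to _⊕_; _*_ to _⊗_; _≟_ to _≟F_)
  open FiniteSum _≟F_ enumeration public

  ring : CommutativeRing _ _
  ring = record { isCommutativeRing = isCommutativeRing }

  open CommutativeRing ring public
    using ( +-assoc; +-comm; +-identityˡ; +-identityʳ; -‿inverseˡ
          ; *-assoc; *-comm; *-identityˡ; *-identityʳ; zeroˡ; zeroʳ; distribˡ )
  open RingProperties (CommutativeRing.ring ring) using (-1*x≈-x; -‿involutive)
  open CommutativeSemigroupProperties (CommutativeRing.+-commutativeSemigroup ring) public
    using (interchange)
  open ≡-Reasoning

  ⊗-cancelʳ : ∀ {a b c} → ¬ c ≡ 0# → a ⊗ c ≡ b ⊗ c → a ≡ b
  ⊗-cancelʳ {a} {b} {c} c≢0 eq with inverse c c≢0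
  ... | c⁻¹ , cc⁻¹ = begin
    a                ≡⟨ sym (*-identityʳ a) ⟩
    a ⊗ 1#           ≡⟨ cong (a ⊗_) (sym cc⁻¹) ⟩
    a ⊗ (c ⊗ c⁻¹)    ≡⟨ sym (*-assoc a c c⁻¹) ⟩
    (a ⊗ c) ⊗ c⁻¹    ≡⟨ cong (_⊗ c⁻¹) eq ⟩
    (b ⊗ c) ⊗ c⁻¹    ≡⟨ *-assoc b c c⁻¹ ⟩
    b ⊗ (c ⊗ c⁻¹)    ≡⟨ cong (b ⊗_) cc⁻¹ ⟩
    b ⊗ 1#           ≡⟨ *-identityʳ b ⟩
    b                ∎

  nonzero-⊗ : ∀ {a b} → ¬ a ≡ 0# → ¬ b ≡ 0# → ¬ a ⊗ b ≡ 0#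
  nonzero-⊗ {a} {b} a≢0 b≢0 ab≡0 = a≢0 (⊗-cancelʳ b≢0 (trans ab≡0 (sym (zeroˡ b))))

  -- Fermat's little theorem x^(q-1) = 1: multiplication by x permutes the
  -- field, so the product of all ν y (y with 0 replaced by 1) equals
  -- x^(number of nonzero y) times itself.
  module Π = MonoidSum (CommutativeRing.*-commutativeMonoid ring)

  ν : Carrier → Carrier
  ν y = if does (y ≟F 0#) then 1# else y

  ν-nonzero : ∀ y → ¬ ν y ≡ 0#
  ν-nonzero y with y ≟F 0#
  ... | yes _ = 0≢1 ∘ sym
  ... | no y≢0 = y≢0

  ν-scale : ∀ {x} → ¬ x ≡ 0# → ∀ y → ν (x ⊗ y) ≡ (if does (y ≟F 0#) then 1# else x) ⊗ ν y
  ν-scale {x} x≢0 y with y ≟F 0# | (x ⊗ y) ≟F 0#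
  ... | yes _    | yes _    = sym (*-identityˡ 1#)
  ... | yes refl | no xy≢0  = ⊥-elim (xy≢0 (zeroʳ x))
  ... | no y≢0   | yes xy≡0 = ⊥-elim (nonzero-⊗ x≢0 y≢0 xy≡0)
  ... | no _     | no _     = refl

  Π-nonzero : ∀ {k} (h : Fin k → Carrier) → (∀ i → ¬ h i ≡ 0#) → ¬ Π.sum h ≡ 0#
  Π-nonzero {zero} h _ = 0≢1 ∘ sym
  Π-nonzero {suc k} h h≢0 = nonzero-⊗ (h≢0 zero) (Π-nonzero (h ∘ suc) (h≢0 ∘ suc))

  Π-select : ∀ {k p} {P : Fin k → Set p} (d : ∀ i → Dec (P i)) x →
    Π.sum (λ i → if does (d i) then 1# else x) ≡ x ^' sum (λ i → ⟦ ¬? (d i) ⟧)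
  Π-select {zero} d x = refl
  Π-select {suc k} d x with d zero
  ... | yes _ = trans (*-identityˡ _) (Π-select (d ∘ suc) x)
  ... | no _ = cong (x ⊗_) (Π-select (d ∘ suc) x)

  nonzero-count : Σ (λ y → ⟦ ¬? (y ≟F 0#) ⟧) ≡ q ∸ 1
  nonzero-count = trans (Σ-complement (_≟F 0#)) (cong (q ∸_) (Σ-unique (_≟F 0#) 0# refl (λ _ → id)))

  scale : Carrier → Fin q → Fin q
  scale a i = to (a ⊗ from i)

  scaling : ∀ {x x⁻¹} → x ⊗ x⁻¹ ≡ 1# → Permutation q q
  scaling {x} {x⁻¹} xx⁻¹ = permutation (scale x) (scale x⁻¹) (undo xx⁻¹) (undo (trans (*-comm x⁻¹ x) xx⁻¹))
    where
    undo : ∀ {a b} → a ⊗ b ≡ 1# → ∀ i → scale a (scale b i) ≡ i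
    undo {a} {b} ab≡1 i = begin
      to (a ⊗ from (to (b ⊗ from i))) ≡⟨ cong (λ z → to (a ⊗ z)) (from-to _) ⟩
      to (a ⊗ (b ⊗ from i))           ≡⟨ cong to (sym (*-assoc a b _)) ⟩
      to ((a ⊗ b) ⊗ from i)           ≡⟨ cong (λ z → to (z ⊗ from i)) ab≡1 ⟩
      to (1# ⊗ from i)                ≡⟨ cong to (*-identityˡ _) ⟩
      to (from i)                     ≡⟨ to-from i ⟩
      i                               ∎

  fermat : ∀ x → ¬ x ≡ 0# → x ^' (q ∸ 1) ≡ 1#
  fermat x x≢0 = sym (⊗-cancelʳ (Π-nonzero (ν ∘ from) (ν-nonzero ∘ from)) product-eq)
    where
    Πν = Π.sum (ν ∘ from)
    x⁻¹ = proj₁ (inverse x x≢0)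
    product-eq : 1# ⊗ Πν ≡ (x ^' (q ∸ 1)) ⊗ Πν
    product-eq = begin
      1# ⊗ Πν                                  ≡⟨ *-identityˡ Πν ⟩
      Πν                                       ≡⟨ Π.sum-permute (ν ∘ from) (scaling {x} {x⁻¹} (proj₂ (inverse x x≢0))) ⟩
      Π.sum (λ i → ν (from (to (x ⊗ from i)))) ≡⟨ Π.sum-cong-≗ (λ i → cong ν (from-to (x ⊗ from i))) ⟩
      Π.sum (λ i → ν (x ⊗ from i))             ≡⟨ Π.sum-cong-≗ (ν-scale x≢0 ∘ from) ⟩
      Π.sum (λ i → (if does (from i ≟F 0#) then 1# else x) ⊗ ν (from i))
                                               ≡⟨ Π.∑-distrib-+ _ (ν ∘ from) ⟩
      Π.sum (λ i → if does (from i ≟F 0#) then 1# else x) ⊗ Πν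
                                               ≡⟨ cong (_⊗ Πν) (Π-select (λ i → from i ≟F 0#) x) ⟩
      (x ^' Σ (λ y → ⟦ ¬? (y ≟F 0#) ⟧)) ⊗ Πν  ≡⟨ cong (λ k → (x ^' k) ⊗ Πν) nonzero-count ⟩
      (x ^' (q ∸ 1)) ⊗ Πν                      ∎

  -- q = 2^m is even and at least 2, since Fin 1 cannot hold 0 ≠ 1
  order-even : ∃ λ k → q ≡ 2 + (k + k)
  order-even = shape m enumeration
    where
    two-power : ∀ n → ∃ λ k → 2 ^ suc n ≡ 2 + (k + k)
    two-power zero = 0 , refl
    two-power (suc n) with two-power n
    ... | k , eq = suc (k + k) , trans (cong (2 *_) eq) (double k)
      where
      double : ∀ k → 2 * (2 + (k + k)) ≡ 2 + (suc (k + k) + suc (k + k))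
      double = solve-∀
    Fin1-unique : (i j : Fin 1) → i ≡ j
    Fin1-unique zero zero = refl
    shape : ∀ n → Carrier ↔ Fin (2 ^ n) → ∃ λ k → 2 ^ n ≡ 2 + (k + k)
    shape zero e = ⊥-elim (0≢1 (begin
      0#                                ≡⟨ sym (Inverse.strictlyInverseʳ e 0#) ⟩
      Inverse.from e (Inverse.to e 0#)  ≡⟨ cong (Inverse.from e) (Fin1-unique (Inverse.to e 0#) (Inverse.to e 1#)) ⟩
      Inverse.from e (Inverse.to e 1#)  ≡⟨ Inverse.strictlyInverseʳ e 1# ⟩
      1#                                ∎))
    shape (suc n) _ = two-power n

  q∸1-odd : ∃ λ k → q ∸ 1 ≡ suc (k + k)
  q∸1-odd = let (k , eq) = order-even in k , cong (_∸ 1) eq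

  suc-q∸2 : suc (q ∸ 2) ≡ q ∸ 1
  suc-q∸2 = let (k , eq) = order-even in trans (cong (λ n → suc (n ∸ 2)) eq) (sym (cong (_∸ 1) eq))

  inverse-power : ∀ {z} → ¬ z ≡ 0# → z ⊗ (z ^' (q ∸ 2)) ≡ 1#
  inverse-power {z} z≢0 = trans (cong (z ^'_) suc-q∸2) (fermat z z≢0)

  odd-power : ∀ {a} → a ⊗ a ≡ 1# → ∀ k → a ^' suc (k + k) ≡ a
  odd-power {a} aa≡1 zero = *-identityʳ a
  odd-power {a} aa≡1 (suc k) = begin
    a ⊗ (a ⊗ (a ^' (k + suc k))) ≡⟨ cong (λ n → a ⊗ (a ⊗ (a ^' n))) (ℕ.+-suc k k) ⟩
    a ⊗ (a ⊗ (a ^' suc (k + k))) ≡⟨ cong (λ z → a ⊗ (a ⊗ z)) (odd-power aa≡1 k) ⟩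
    a ⊗ (a ⊗ a)                  ≡⟨ cong (a ⊗_) aa≡1 ⟩
    a ⊗ 1#                       ≡⟨ *-identityʳ a ⟩
    a                            ∎

  -- The characteristic is 2: -1 = (-1)^(q-1) = 1 because q - 1 is odd.
  characteristic-2 : ∀ x → x ⊕ x ≡ 0#
  characteristic-2 x = begin
    x ⊕ x                ≡⟨ cong₂ _⊕_ (sym (*-identityʳ x)) (sym (*-identityʳ x)) ⟩
    x ⊗ 1# ⊕ x ⊗ 1#      ≡⟨ sym (distribˡ x 1# 1#) ⟩
    x ⊗ (1# ⊕ 1#)        ≡⟨ cong (λ z → x ⊗ (z ⊕ 1#)) (sym minus-one) ⟩
    x ⊗ ((- 1#) ⊕ 1#)    ≡⟨ cong (x ⊗_) (-‿inverseˡ 1#) ⟩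
    x ⊗ 0#               ≡⟨ zeroʳ x ⟩
    0#                   ∎
    where
    minus-one-nonzero : ¬ - 1# ≡ 0#
    minus-one-nonzero eq = 0≢1 (sym (begin
      1#             ≡⟨ sym (+-identityˡ 1#) ⟩
      0# ⊕ 1#        ≡⟨ cong (_⊕ 1#) (sym eq) ⟩
      (- 1#) ⊕ 1#    ≡⟨ -‿inverseˡ 1# ⟩
      0#             ∎))
    minus-one : - 1# ≡ 1#
    minus-one = let (k , eq) = q∸1-odd in begin
      - 1#                     ≡⟨ sym (odd-power (trans (-1*x≈-x (- 1#)) (-‿involutive 1#)) k) ⟩
      (- 1#) ^' suc (k + k)    ≡⟨ cong ((- 1#) ^'_) (sym eq) ⟩
      (- 1#) ^' (q ∸ 1)        ≡⟨ fermat (- 1#) minus-one-nonzero ⟩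
      1#                       ∎

  ⊕-cancelʳ : ∀ a b → (a ⊕ b) ⊕ b ≡ a
  ⊕-cancelʳ a b = trans (+-assoc a b b) (trans (cong (a ⊕_) (characteristic-2 b)) (+-identityʳ a))

  ⊕-cancelˡ : ∀ a b → a ⊕ (a ⊕ b) ≡ b
  ⊕-cancelˡ a b = trans (sym (+-assoc a a b)) (trans (cong (_⊕ b) (characteristic-2 a)) (+-identityˡ b))

  ⊕-flip : ∀ {a b c} → a ≡ b ⊕ c → c ≡ b ⊕ a
  ⊕-flip {a} {b} {c} eq = trans (sym (⊕-cancelˡ b c)) (cong (b ⊕_) (sym eq))

  ⊕≡0⇒≡ : ∀ {a b} → a ⊕ b ≡ 0# → a ≡ b
  ⊕≡0⇒≡ {a} {b} eq = sym (trans (⊕-flip (sym eq)) (+-identityʳ a))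

  ⊕-exchange : ∀ {a b c e} → a ⊕ b ≡ c ⊕ e → a ⊕ c ≡ b ⊕ e
  ⊕-exchange {a} {b} {c} {e} eq = ⊕≡0⇒≡ (begin
    (a ⊕ c) ⊕ (b ⊕ e)  ≡⟨ interchange a c b e ⟩
    (a ⊕ b) ⊕ (c ⊕ e)  ≡⟨ cong (_⊕ (c ⊕ e)) eq ⟩
    (c ⊕ e) ⊕ (c ⊕ e)  ≡⟨ characteristic-2 (c ⊕ e) ⟩
    0#                 ∎)

  nonzero-solutions : ∀ {t} s d → ¬ t ≡ 0# →
    Σ (λ b → ⟦ ¬? (b ≟F 0#) ×-dec ((s ⊕ b ⊗ t) ≟F d) ⟧) ≡ ⟦ ¬? (s ≟F d) ⟧
  nonzero-solutions {t} s d t≢0 with s ≟F d | inverse t t≢0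
  ... | yes refl | _ = Σ-zero λ b → ⟦⟧-no (¬? (b ≟F 0#) ×-dec ((s ⊕ b ⊗ t) ≟F s))
          λ (b≢0 , eq) → nonzero-⊗ b≢0 t≢0 (trans (⊕-flip (sym eq)) (characteristic-2 s))
  ... | no s≢d | t⁻¹ , tt⁻¹ =
        Σ-unique (λ b → ¬? (b ≟F 0#) ×-dec ((s ⊕ b ⊗ t) ≟F d)) b₀ (b₀≢0 , solves) unique
    where
    b₀ = (s ⊕ d) ⊗ t⁻¹
    b₀t : b₀ ⊗ t ≡ s ⊕ d
    b₀t = begin
      ((s ⊕ d) ⊗ t⁻¹) ⊗ t  ≡⟨ *-assoc (s ⊕ d) t⁻¹ t ⟩
      (s ⊕ d) ⊗ (t⁻¹ ⊗ t)  ≡⟨ cong ((s ⊕ d) ⊗_) (trans (*-comm t⁻¹ t) tt⁻¹) ⟩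
      (s ⊕ d) ⊗ 1#         ≡⟨ *-identityʳ (s ⊕ d) ⟩
      s ⊕ d                ∎
    b₀≢0 : ¬ b₀ ≡ 0#
    b₀≢0 = nonzero-⊗ (s≢d ∘ ⊕≡0⇒≡) t⁻¹≢0
      where
      t⁻¹≢0 : ¬ t⁻¹ ≡ 0#
      t⁻¹≢0 t⁻¹≡0 = 0≢1 (trans (sym (zeroʳ t)) (trans (cong (t ⊗_) (sym t⁻¹≡0)) tt⁻¹))
    solves : s ⊕ b₀ ⊗ t ≡ d
    solves = trans (cong (s ⊕_) b₀t) (⊕-cancelˡ s d)
    unique : ∀ b → ¬ b ≡ 0# × s ⊕ b ⊗ t ≡ d → b ≡ b₀
    unique b (_ , eq) = ⊗-cancelʳ t≢0 (trans (⊕-flip (sym eq)) (sym b₀t))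

module Fibres {m : ℕ} (F : GF2^ m) where

  open GF2^ F renaming (_+_ to _⊕_; _*_ to _⊗_; _≟_ to _≟F_)
  open FieldFacts F

  fibre : (Carrier → Carrier) → Carrier → ℕ
  fibre g v = Σ (λ x → ⟦ g x ≟F v ⟧)

  TwoToOne : (Carrier → Carrier) → Set
  TwoToOne g = ∀ x₀ → ∃ λ x₁ → ¬ x₀ ≡ x₁ × (∀ y → g y ≡ g x₀ ⇔ (y ≡ x₀ ⊎ y ≡ x₁))

  fibre-two-to-one : ∀ {g} → TwoToOne g → ∀ v → fibre g v ≡ 2 * ⟦ v ∈V? g ⟧
  fibre-two-to-one {g} two v with v ∈V? g
  ... | no v∉V = Σ-zero (λ x → ⟦⟧-no (g x ≟F v) (λ gx≡v → v∉V (x , gx≡v)))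
  ... | yes (x₀ , gx₀≡v) with two x₀
  ... | x₁ , x₀≢x₁ , same = Σ-pair (λ x → g x ≟F v) x₀ x₁ x₀≢x₁ λ y → mk⇔
          (λ gy≡v → Equivalence.to (same y) (trans gy≡v (sym gx₀≡v)))
          (λ y∈ → trans (Equivalence.from (same y) y∈) gx₀≡v)

  ∈V-translate : ∀ g u c → u ∈V (λ x → g x ⊕ c) ⇔ (u ⊕ c) ∈V g
  ∈V-translate g u c = mk⇔
    (λ (x , eq) → x , trans (sym (⊕-cancelʳ (g x) c)) (cong (_⊕ c) eq))
    (λ (x , eq) → x , trans (cong (_⊕ c) eq) (⊕-cancelʳ u c))

  shifted-fibres : ∀ g u₁ u₂ →
    Σ (λ c → fibre g (u₁ ⊕ c) * fibre g (u₂ ⊕ c)) ≡ Σ (λ x → Σ (λ y → ⟦ (g x ⊕ g y) ≟F (u₁ ⊕ u₂) ⟧))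
  shifted-fibres g u₁ u₂ = begin
    Σ (λ c → fibre g (u₁ ⊕ c) * fibre g (u₂ ⊕ c))
      ≡⟨ Σ-cong (λ c → Σ-product (λ x → ⟦ g x ≟F (u₁ ⊕ c) ⟧) (λ y → ⟦ g y ≟F (u₂ ⊕ c) ⟧)) ⟩
    Σ (λ c → Σ (λ x → Σ (λ y → ⟦ g x ≟F (u₁ ⊕ c) ⟧ * ⟦ g y ≟F (u₂ ⊕ c) ⟧)))
      ≡⟨ Σ-comm (λ c x → Σ (λ y → ⟦ g x ≟F (u₁ ⊕ c) ⟧ * ⟦ g y ≟F (u₂ ⊕ c) ⟧)) ⟩
    Σ (λ x → Σ (λ c → Σ (λ y → ⟦ g x ≟F (u₁ ⊕ c) ⟧ * ⟦ g y ≟F (u₂ ⊕ c) ⟧)))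
      ≡⟨ Σ-cong (λ x → Σ-comm (λ c y → ⟦ g x ≟F (u₁ ⊕ c) ⟧ * ⟦ g y ≟F (u₂ ⊕ c) ⟧)) ⟩
    Σ (λ x → Σ (λ y → Σ (λ c → ⟦ g x ≟F (u₁ ⊕ c) ⟧ * ⟦ g y ≟F (u₂ ⊕ c) ⟧)))
      ≡⟨ Σ-cong (λ x → Σ-cong (λ y → Σ-cong (λ c → cong₂ _*_ (solve-for-c (g x) u₁ c) (solve-for-c (g y) u₂ c)))) ⟩
    Σ (λ x → Σ (λ y → Σ (λ c → ⟦ c ≟F (u₁ ⊕ g x) ⟧ * ⟦ c ≟F (u₂ ⊕ g y) ⟧)))
      ≡⟨ Σ-cong (λ x → Σ-cong (λ y → Σ-two-points (u₁ ⊕ g x) (u₂ ⊕ g y))) ⟩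
    Σ (λ x → Σ (λ y → ⟦ (u₁ ⊕ g x) ≟F (u₂ ⊕ g y) ⟧))
      ≡⟨ Σ-cong (λ x → Σ-cong (λ y → ⟦⟧-cong ((u₁ ⊕ g x) ≟F (u₂ ⊕ g y)) ((g x ⊕ g y) ≟F (u₁ ⊕ u₂))
           (sym ∘ ⊕-exchange)
           (λ eq → trans (+-comm u₁ (g x)) (trans (⊕-exchange eq) (+-comm (g y) u₂))))) ⟩
    Σ (λ x → Σ (λ y → ⟦ (g x ⊕ g y) ≟F (u₁ ⊕ u₂) ⟧)) ∎
    where
    open ≡-Reasoning
    solve-for-c : ∀ a u c → ⟦ a ≟F (u ⊕ c) ⟧ ≡ ⟦ c ≟F (u ⊕ a) ⟧
    solve-for-c a u c = ⟦⟧-cong (a ≟F (u ⊕ c)) (c ≟F (u ⊕ a)) ⊕-flip ⊕-flip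

module OPolynomial {m : ℕ} (F : GF2^ m) (f : GF2^.Poly F) (o : GF2^.IsOPolynomial F f) where

  open GF2^ F renaming (_+_ to _⊕_; _*_ to _⊗_; _≟_ to _≟F_)
  open FieldFacts F
  open Fibres F
  open IsOPolynomial o
  open ≡-Reasoning

  g : Carrier → Carrier → Carrier
  g b x = eval f x ⊕ b ⊗ x

  g-sum : ∀ b x y → g b x ⊕ g b y ≡ (eval f x ⊕ eval f y) ⊕ b ⊗ (x ⊕ y)
  g-sum b x y = trans (interchange (eval f x) (b ⊗ x) (eval f y) (b ⊗ y))
                      (cong ((eval f x ⊕ eval f y) ⊕_) (sym (distribˡ b x y)))

  same-value : ∀ b x y → g b y ≡ g b x ⇔ eval f y ⊕ eval f x ≡ b ⊗ (y ⊕ x)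
  same-value b x y = mk⇔
    (λ eq → ⊕≡0⇒≡ (trans (sym (g-sum b y x)) (trans (cong (_⊕ g b x) eq) (characteristic-2 (g b x)))))
    (λ eq → ⊕≡0⇒≡ (trans (g-sum b y x) (trans (cong (_⊕ b ⊗ (y ⊕ x)) eq) (characteristic-2 (b ⊗ (y ⊕ x))))))

  -- the slope of the chord from x₀ to z + x₀, the map in the o-polynomial condition
  slope : Carrier → Carrier → Carrier
  slope x₀ z = (eval f (z ⊕ x₀) ⊕ eval f x₀) ⊗ (z ^' (q ∸ 2))

  slope-zero : ∀ x₀ → slope x₀ 0# ≡ 0#
  slope-zero x₀ = begin
    (eval f (0# ⊕ x₀) ⊕ eval f x₀) ⊗ w  ≡⟨ cong (λ z → (eval f z ⊕ eval f x₀) ⊗ w) (+-identityˡ x₀) ⟩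
    (eval f x₀ ⊕ eval f x₀) ⊗ w         ≡⟨ cong (_⊗ w) (characteristic-2 (eval f x₀)) ⟩
    0# ⊗ w                              ≡⟨ zeroˡ w ⟩
    0#                                  ∎
    where
    w = 0# ^' (q ∸ 2)

  slope-eq : ∀ {x₀ z} b → ¬ z ≡ 0# → slope x₀ z ≡ b ⇔ eval f (z ⊕ x₀) ⊕ eval f x₀ ≡ b ⊗ z
  slope-eq {x₀} {z} b z≢0 = mk⇔
    (λ eq → begin
      D                    ≡⟨ sym (*-identityʳ D) ⟩
      D ⊗ 1#               ≡⟨ cong (D ⊗_) (sym (inverse-power z≢0)) ⟩
      D ⊗ (z ⊗ w)          ≡⟨ cong (D ⊗_) (*-comm z w) ⟩
      D ⊗ (w ⊗ z)          ≡⟨ sym (*-assoc D w z) ⟩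
      slope x₀ z ⊗ z       ≡⟨ cong (_⊗ z) eq ⟩
      b ⊗ z                ∎)
    (λ eq → begin
      D ⊗ w                ≡⟨ cong (_⊗ w) eq ⟩
      (b ⊗ z) ⊗ w          ≡⟨ *-assoc b z w ⟩
      b ⊗ (z ⊗ w)          ≡⟨ cong (b ⊗_) (inverse-power z≢0) ⟩
      b ⊗ 1#               ≡⟨ *-identityʳ b ⟩
      b                    ∎)
    where
    D = eval f (z ⊕ x₀) ⊕ eval f x₀
    w = z ^' (q ∸ 2)

  same-value-slope : ∀ b x₀ y → ¬ y ≡ x₀ → g b y ≡ g b x₀ ⇔ slope x₀ (y ⊕ x₀) ≡ b
  same-value-slope b x₀ y y≢x₀ = mk⇔
    (λ eq → Equivalence.from (slope-eq b z≢0)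
              (trans (cong (λ v → eval f v ⊕ eval f x₀) (⊕-cancelʳ y x₀)) (Equivalence.to (same-value b x₀ y) eq)))
    (λ eq → Equivalence.from (same-value b x₀ y)
              (trans (cong (λ v → eval f v ⊕ eval f x₀) (sym (⊕-cancelʳ y x₀))) (Equivalence.to (slope-eq b z≢0) eq)))
    where
    z≢0 : ¬ y ⊕ x₀ ≡ 0#
    z≢0 = y≢x₀ ∘ ⊕≡0⇒≡

  -- Key consequence of the o-polynomial property: for b ≠ 0 the map
  -- g_b is two-to-one, the partner of x₀ being x₀ + (slope x₀)⁻¹(b).
  g-two-to-one : ∀ {b} → ¬ b ≡ 0# → TwoToOne (g b)
  g-two-to-one {b} b≢0 x₀ = x₁ , x₀≢x₁ , λ y → mk⇔ (partner-of y) is-partner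
    where
    z₁ = proj₁ (proj₂ (perm-a x₀) b)
    slope-z₁ : slope x₀ z₁ ≡ b
    slope-z₁ = proj₂ (proj₂ (perm-a x₀) b) refl
    x₁ = z₁ ⊕ x₀
    x₀≢x₁ : ¬ x₀ ≡ x₁
    x₀≢x₁ eq = b≢0 (trans (sym slope-z₁) (trans (cong (slope x₀) z₁≡0) (slope-zero x₀)))
      where
      z₁≡0 : z₁ ≡ 0#
      z₁≡0 = trans (sym (⊕-cancelʳ z₁ x₀)) (trans (cong (_⊕ x₀) (sym eq)) (characteristic-2 x₀))
    partner-of : ∀ y → g b y ≡ g b x₀ → y ≡ x₀ ⊎ y ≡ x₁
    partner-of y eq with y ≟F x₀
    ... | yes y≡x₀ = inj₁ y≡x₀
    ... | no y≢x₀ = inj₂ (trans (sym (⊕-cancelʳ y x₀)) (cong (_⊕ x₀) y⊕x₀≡z₁))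
      where
      y⊕x₀≡z₁ : y ⊕ x₀ ≡ z₁
      y⊕x₀≡z₁ = proj₁ (perm-a x₀) (trans (Equivalence.to (same-value-slope b x₀ y y≢x₀) eq) (sym slope-z₁))
    is-partner : ∀ {y} → y ≡ x₀ ⊎ y ≡ x₁ → g b y ≡ g b x₀
    is-partner (inj₁ refl) = refl
    is-partner (inj₂ refl) = Equivalence.from (same-value-slope b x₀ x₁ (x₀≢x₁ ∘ sym))
                         (trans (cong (slope x₀) (⊕-cancelʳ z₁ x₀)) slope-z₁)

  module Count (u₁ u₂ : Carrier) (u₁≢u₂ : ¬ u₁ ≡ u₂) where

    d : Carrier
    d = u₁ ⊕ u₂

    d≢0 : ¬ d ≡ 0#
    d≢0 = u₁≢u₂ ∘ ⊕≡0⇒≡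

    good : Carrier → Carrier → ℕ
    good b c = ⟦ u₁ ∈V? (λ x → g b x ⊕ c) ⟧ * ⟦ u₂ ∈V? (λ x → g b x ⊕ c) ⟧

    pairs : Carrier → ℕ
    pairs b = Σ (λ x → Σ (λ y → ⟦ (g b x ⊕ g b y) ≟F d ⟧))

    cardI-as-sum : cardI f u₁ u₂ ≡ Σ (λ b → ⟦ ¬? (b ≟F 0#) ⟧ * Σ (good b))
    cardI-as-sum = begin
      cardI f u₁ u₂
        ≡⟨ length-filter (InI? f u₁ u₂) (cartesianProduct elements elements) ⟩
      weight (λ p → ⟦ InI? f u₁ u₂ p ⟧) (cartesianProduct elements elements)
        ≡⟨ weight-cartesianProduct (λ p → ⟦ InI? f u₁ u₂ p ⟧) elements elements ⟩
      weight (λ b → weight (λ c → ⟦ InI? f u₁ u₂ (b , c) ⟧) elements) elements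
        ≡⟨ weight-elements (λ b → weight (λ c → ⟦ InI? f u₁ u₂ (b , c) ⟧) elements) ⟩
      Σ (λ b → weight (λ c → ⟦ InI? f u₁ u₂ (b , c) ⟧) elements)
        ≡⟨ Σ-cong (λ b → weight-elements (λ c → ⟦ InI? f u₁ u₂ (b , c) ⟧)) ⟩
      Σ (λ b → Σ (λ c → ⟦ InI? f u₁ u₂ (b , c) ⟧))
        ≡⟨ Σ-cong (λ b → Σ-cong (split b)) ⟩
      Σ (λ b → Σ (λ c → ⟦ ¬? (b ≟F 0#) ⟧ * good b c))
        ≡⟨ Σ-cong (λ b → Σ-*ˡ ⟦ ¬? (b ≟F 0#) ⟧ (good b)) ⟩
      Σ (λ b → ⟦ ¬? (b ≟F 0#) ⟧ * Σ (good b)) ∎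
      where
      split : ∀ b c → ⟦ InI? f u₁ u₂ (b , c) ⟧ ≡ ⟦ ¬? (b ≟F 0#) ⟧ * good b c
      split b c = trans (⟦⟧-× (¬? (b ≟F 0#)) (u₁ ∈V? (λ x → g b x ⊕ c) ×-dec u₂ ∈V? (λ x → g b x ⊕ c)))
                        (cong (⟦ ¬? (b ≟F 0#) ⟧ *_) (⟦⟧-× (u₁ ∈V? (λ x → g b x ⊕ c)) (u₂ ∈V? (λ x → g b x ⊕ c))))

    -- for b ≠ 0, each good c accounts for 2 · 2 pairs, since g_b is two-to-one
    translates-count : ∀ {b} → ¬ b ≡ 0# → 4 * Σ (good b) ≡ pairs b
    translates-count {b} b≢0 = begin
      4 * Σ (good b)
        ≡⟨ sym (Σ-*ˡ 4 (good b)) ⟩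
      Σ (λ c → 4 * good b c)
        ≡⟨ Σ-cong (λ c → doubling ⟦ u₁ ∈V? (λ x → g b x ⊕ c) ⟧ ⟦ u₂ ∈V? (λ x → g b x ⊕ c) ⟧) ⟩
      Σ (λ c → (2 * ⟦ u₁ ∈V? (λ x → g b x ⊕ c) ⟧) * (2 * ⟦ u₂ ∈V? (λ x → g b x ⊕ c) ⟧))
        ≡⟨ Σ-cong (λ c → cong₂ _*_ (as-fibre u₁ c) (as-fibre u₂ c)) ⟩
      Σ (λ c → fibre (g b) (u₁ ⊕ c) * fibre (g b) (u₂ ⊕ c))
        ≡⟨ shifted-fibres (g b) u₁ u₂ ⟩
      pairs b ∎
      where
      doubling : ∀ a a′ → 4 * (a * a′) ≡ (2 * a) * (2 * a′)
      doubling = solve-∀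
      as-fibre : ∀ u c → 2 * ⟦ u ∈V? (λ x → g b x ⊕ c) ⟧ ≡ fibre (g b) (u ⊕ c)
      as-fibre u c = trans
        (cong (2 *_) (⟦⟧-cong (u ∈V? (λ x → g b x ⊕ c)) ((u ⊕ c) ∈V? g b)
          (Equivalence.to (∈V-translate (g b) u c)) (Equivalence.from (∈V-translate (g b) u c))))
        (sym (fibre-two-to-one (g-two-to-one b≢0) (u ⊕ c)))

    slopes-count : ∀ x y → Σ (λ b → ⟦ ¬? (b ≟F 0#) ×-dec ((g b x ⊕ g b y) ≟F d) ⟧)
                           ≡ ⟦ ¬? (y ≟F x) ×-dec ¬? ((eval f x ⊕ eval f y) ≟F d) ⟧
    slopes-count x y with y ≟F x
    ... | yes refl = Σ-zero λ b → ⟦⟧-no (¬? (b ≟F 0#) ×-dec ((g b x ⊕ g b x) ≟F d))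
                       λ (_ , eq) → d≢0 (trans (sym eq) (characteristic-2 (g b x)))
    ... | no y≢x = begin
      Σ (λ b → ⟦ ¬? (b ≟F 0#) ×-dec ((g b x ⊕ g b y) ≟F d) ⟧)
        ≡⟨ Σ-cong (λ b → cong (λ v → ⟦ ¬? (b ≟F 0#) ×-dec (v ≟F d) ⟧) (g-sum b x y)) ⟩
      Σ (λ b → ⟦ ¬? (b ≟F 0#) ×-dec (((eval f x ⊕ eval f y) ⊕ b ⊗ (x ⊕ y)) ≟F d) ⟧)
        ≡⟨ nonzero-solutions (eval f x ⊕ eval f y) d (y≢x ∘ sym ∘ ⊕≡0⇒≡) ⟩
      ⟦ ¬? ((eval f x ⊕ eval f y) ≟F d) ⟧
        ≡⟨ ⟦⟧-cong (¬? ((eval f x ⊕ eval f y) ≟F d)) (¬? (no y≢x) ×-dec ¬? ((eval f x ⊕ eval f y) ≟F d)) (y≢x ,_) proj₂ ⟩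
      ⟦ ¬? (no y≢x) ×-dec ¬? ((eval f x ⊕ eval f y) ≟F d) ⟧ ∎

    -- since f is a permutation, exactly two y violate y ≠ x, f x + f y ≠ u₁ + u₂:
    -- y = x and y = f⁻¹(f x + u₁ + u₂)
    partners : ∀ x → Σ (λ y → ⟦ ¬? (y ≟F x) ×-dec ¬? ((eval f x ⊕ eval f y) ≟F d) ⟧) ≡ q ∸ 2
    partners x = begin
      Σ (λ y → ⟦ ¬? (y ≟F x) ×-dec ¬? ((eval f x ⊕ eval f y) ≟F d) ⟧)
        ≡⟨ Σ-cong (λ y → ⟦⟧-cong (¬? (y ≟F x) ×-dec ¬? ((eval f x ⊕ eval f y) ≟F d)) (¬? (excluded? y))
             (λ (y≢x , sum≢d) → λ { (inj₁ y≡x) → y≢x y≡x ; (inj₂ refl) → sum≢d hits-d })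
             (λ ¬excluded → (¬excluded ∘ inj₁) , (¬excluded ∘ inj₂ ∘ to-y₀))) ⟩
      Σ (λ y → ⟦ ¬? (excluded? y) ⟧)
        ≡⟨ Σ-complement excluded? ⟩
      q ∸ Σ (λ y → ⟦ excluded? y ⟧)
        ≡⟨ cong (q ∸_) (Σ-pair excluded? x y₀ x≢y₀ (λ y → mk⇔ id id)) ⟩
      q ∸ 2 ∎
      where
      y₀ = proj₁ (proj₂ perm (eval f x ⊕ d))
      f-y₀ : eval f y₀ ≡ eval f x ⊕ d
      f-y₀ = proj₂ (proj₂ perm (eval f x ⊕ d)) refl
      hits-d : eval f x ⊕ eval f y₀ ≡ d
      hits-d = trans (cong (eval f x ⊕_) f-y₀) (⊕-cancelˡ (eval f x) d)
      to-y₀ : ∀ {y} → eval f x ⊕ eval f y ≡ d → y ≡ y₀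
      to-y₀ eq = proj₁ perm (trans (⊕-flip (sym eq)) (sym f-y₀))
      x≢y₀ : ¬ x ≡ y₀
      x≢y₀ x≡y₀ = d≢0 (begin
        d                          ≡⟨ sym hits-d ⟩
        eval f x ⊕ eval f y₀       ≡⟨ cong (λ v → eval f x ⊕ eval f v) (sym x≡y₀) ⟩
        eval f x ⊕ eval f x        ≡⟨ characteristic-2 (eval f x) ⟩
        0#                         ∎)
      excluded? : ∀ y → Dec (y ≡ x ⊎ y ≡ y₀)
      excluded? y = y ≟F x ⊎-dec y ≟F y₀

    four-cardI : 4 * cardI f u₁ u₂ ≡ q * (q ∸ 2)
    four-cardI = begin
      4 * cardI f u₁ u₂
        ≡⟨ cong (4 *_) cardI-as-sum ⟩
      4 * Σ (λ b → ⟦ ¬? (b ≟F 0#) ⟧ * Σ (good b))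
        ≡⟨ sym (Σ-*ˡ 4 (λ b → ⟦ ¬? (b ≟F 0#) ⟧ * Σ (good b))) ⟩
      Σ (λ b → 4 * (⟦ ¬? (b ≟F 0#) ⟧ * Σ (good b)))
        ≡⟨ Σ-cong (λ b → trans (reorder ⟦ ¬? (b ≟F 0#) ⟧ (Σ (good b))) (⟦⟧-guard (¬? (b ≟F 0#)) translates-count)) ⟩
      Σ (λ b → ⟦ ¬? (b ≟F 0#) ⟧ * pairs b)
        ≡⟨ Σ-cong distribute ⟩
      Σ (λ b → Σ (λ x → Σ (λ y → ⟦ ¬? (b ≟F 0#) ×-dec ((g b x ⊕ g b y) ≟F d) ⟧)))
        ≡⟨ Σ-comm (λ b x → Σ (λ y → ⟦ ¬? (b ≟F 0#) ×-dec ((g b x ⊕ g b y) ≟F d) ⟧)) ⟩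
      Σ (λ x → Σ (λ b → Σ (λ y → ⟦ ¬? (b ≟F 0#) ×-dec ((g b x ⊕ g b y) ≟F d) ⟧)))
        ≡⟨ Σ-cong (λ x → Σ-comm (λ b y → ⟦ ¬? (b ≟F 0#) ×-dec ((g b x ⊕ g b y) ≟F d) ⟧)) ⟩
      Σ (λ x → Σ (λ y → Σ (λ b → ⟦ ¬? (b ≟F 0#) ×-dec ((g b x ⊕ g b y) ≟F d) ⟧)))
        ≡⟨ Σ-cong (λ x → Σ-cong (slopes-count x)) ⟩
      Σ (λ x → Σ (λ y → ⟦ ¬? (y ≟F x) ×-dec ¬? ((eval f x ⊕ eval f y) ≟F d) ⟧))
        ≡⟨ Σ-cong partners ⟩
      Σ (λ _ → q ∸ 2)
        ≡⟨ Σ-const (q ∸ 2) ⟩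
      q * (q ∸ 2) ∎
      where
      reorder : ∀ a b → 4 * (a * b) ≡ a * (4 * b)
      reorder = solve-∀
      distribute : ∀ b → ⟦ ¬? (b ≟F 0#) ⟧ * pairs b
                         ≡ Σ (λ x → Σ (λ y → ⟦ ¬? (b ≟F 0#) ×-dec ((g b x ⊕ g b y) ≟F d) ⟧))
      distribute b = trans (sym (Σ-*ˡ ⟦ ¬? (b ≟F 0#) ⟧ (λ x → Σ (λ y → ⟦ (g b x ⊕ g b y) ≟F d ⟧))))
                       (Σ-cong λ x → trans (sym (Σ-*ˡ ⟦ ¬? (b ≟F 0#) ⟧ (λ y → ⟦ (g b x ⊕ g b y) ≟F d ⟧)))
                       (Σ-cong λ y → sym (⟦⟧-× (¬? (b ≟F 0#)) ((g b x ⊕ g b y) ≟F d))))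

mainTheorem12 : (m : ℕ) (F : GF2^ m) →
    (f : GF2^.Poly F) → GF2^.IsOPolynomial F f →
    (u₁ u₂ : GF2^.Carrier F) → ¬ (u₁ ≡ u₂) →
    GF2^.cardI F f u₁ u₂ ≡ (GF2^.q F * (GF2^.q F ∸ 2)) / 4
mainTheorem12 m F f o u₁ u₂ u₁≢u₂ = begin
  cardI f u₁ u₂                ≡⟨ sym (m*n/n≡m (cardI f u₁ u₂) 4) ⟩
  cardI f u₁ u₂ * 4 / 4        ≡⟨ cong (_/ 4) (trans (ℕ.*-comm (cardI f u₁ u₂) 4) four-cardI) ⟩
  q * (q ∸ 2) / 4              ∎
  where
  open GF2^ F using (q; cardI)
  open OPolynomial F f o using (module Count)
  open Count u₁ u₂ u₁≢u₂ using (four-cardI)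
  open ≡-Reasoning
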